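{- Let $n\ge 1$ and let $(A,B,W)$ be a partition of $V=\{0,1\}^n$ with $\mu(A)=1/2$. Then \[|\nabla(A,B)| + n^{\beta}\,|W| \;\ge\; 2^{n-1},\] where $\beta=\log_2(3/2)$.
   Context: $V=\{0,1\}^n$ is the vertex set of the Hamming cube $Q_n$ (vertices adjacent iff they differ in exactly one coordinate), and $\mu$ is the uniform probability measure on $V$. For disjoint $A,B\subseteq V$, $\nabla(A,B)$ is the set of ordered pairs $(x,y)$ of adjacent vertices with $x\in A$, $y\in B$. -}

module Defs where

open import Data.Bool using (Bool; true; false; if_then_else_; _∧_)
open import Data.Nat using (ℕ; zero; suc; _+_; _*_; _^_; _≤_; _<_; _∸_; _≡ᵇ_)
open import Data.Vec using (Vec; []; _∷_)
open import Data.List using (List; []; _∷_; map; _++_)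

allVertices : (n : ℕ) → List (Vec Bool n)
allVertices zero = [] ∷ []
allVertices (suc n) = map (false ∷_) (allVertices n) ++ map (true ∷_) (allVertices n)

hamming : {n : ℕ} → Vec Bool n → Vec Bool n → ℕ
hamming [] [] = zero
hamming (false ∷ xs) (false ∷ ys) = hamming xs ys
hamming (true ∷ xs) (true ∷ ys) = hamming xs ys
hamming (false ∷ xs) (true ∷ ys) = suc (hamming xs ys)
hamming (true ∷ xs) (false ∷ ys) = suc (hamming xs ys)

adjacentᵇ : {n : ℕ} → Vec Bool n → Vec Bool n → Bool
adjacentᵇ x y = hamming x y ≡ᵇ 1

count : {X : Set} → (X → Bool) → List X → ℕ
count p [] = zero
count p (x ∷ xs) = if p x then suc (count p xs) else count p xs

-- A partition (A,B,W) of V is a labelling of each vertex by its part.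
data Part : Set where
  partA partB partW : Part

isA isB isW : Part → Bool
isA partA = true
isA _ = false
isB partB = true
isB _ = false
isW partW = true
isW _ = false

cardA cardW : (n : ℕ) → (Vec Bool n → Part) → ℕ
cardA n f = count (λ x → isA (f x)) (allVertices n)
cardW n f = count (λ x → isW (f x)) (allVertices n)

sumOver : {X : Set} → (X → ℕ) → List X → ℕ
sumOver g [] = zero
sumOver g (x ∷ xs) = g x + sumOver g xs

edgeAB : (n : ℕ) → (Vec Bool n → Part) → ℕ
edgeAB n f =
  sumOver (λ x → count (λ y → isA (f x) ∧ (isB (f y) ∧ adjacentᵇ x y)) (allVertices n))
          (allVertices n)

-- β = log₂(3/2).  For naturals N, w, M and n ≥ 1,
--   BetaIneq n N w M   means   N + n^β · w ≥ M   (real arithmetic).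
-- Encoding without reals: since n ≥ 1 and w ≥ 0, e ↦ N + n^e·w is continuous and
-- nondecreasing, so N + n^β w ≥ M iff N + n^(r/s) w ≥ M for every rational r/s > β.
-- For s ≥ 1:  r/s > log₂(3/2)  ⇔  3^s < 2^(r+s),   and
--   N + n^(r/s) w ≥ M  ⇔  (M ∸ N)^s ≤ w^s · n^r.
BetaIneq : ℕ → ℕ → ℕ → ℕ → Set
BetaIneq n N w M =
  (r s : ℕ) → 1 ≤ s → 3 ^ s < 2 ^ (r + s) → (M ∸ N) ^ s ≤ (w ^ s) * (n ^ r)

-- Let f be the indicator of the complement of A and B(p) = 2p(1 - p). Splitting the cube along its
-- first coordinate and using the two-point inequality
--   2 B((p + q)/2) ≤ S(p, q) + S(q, p),  where  S(p, q) = B(p) - u²B(p)/2 + u (p - q)⁺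
--   and  u = min(2(p - q)⁺, 1),
-- an induction on the dimension gives B(𝔼 f) ≤ 𝔼 Φ, where Φ(y) starts from B(f(y)) and applies one
-- step a ↦ a - u²a/2 + u d per coordinate, d being the positive part of the drop of f along that edge
-- and u ∈ [0, 1] a control. For the indicator, d ∈ {0, 1} and d = 1 exactly for the edges from a
-- vertex outside A to A, so Φ ≤ 0 on A and Φ ≤ (number of A-neighbours) on B; moreover after k unit
-- steps a ≤ k and 8a² ≤ 9k, so Φ ≤ √(9n/8) everywhere. Since B(1/2) = 1/2, summing over the cube gives
-- |A| ≤ |∇(A,B)| + √(9n/8) |W|, and √(9n/8) ≤ n^β for n ≥ 2, with equality at n = 2 as 2^β = 3/2.
-- For n = 1 the same bound suffices because then |A| - |∇(A,B)| ≤ 1.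
module Submission where

open import Defs

open import Agda.Builtin.FromNat using (Number; fromNat)
open import Data.Nat.Base using (ℕ)
open import Data.Nat.Literals renaming (number to ℕ-literals)
open import Data.Rational.Base using (ℚ)
open import Data.Rational.Literals renaming (number to ℚ-literals)
open import Data.Unit using (tt)

instance
  ℕ-number : Number ℕ
  ℕ-number = ℕ-literals

  ℚ-number : Number ℚ
  ℚ-number = ℚ-literals

module ℚ-Arithmetic where

  open import Data.Empty using (⊥-elim)
  import Data.Nat as Nat
  open Nat using (zero; suc; z≤n; s≤s)
  open import Data.Rational
  open import Data.Rational.Properties
  open import Data.Sum using (inj₁; inj₂)
  open import Relation.Binary.PropositionalEquality
  open import Relation.Nullary.Decidable using (dec⇒maybe)
  open import Tactic.RingSolver using (solve-∀)
  open import Tactic.RingSolver.Core.AlmostCommutativeRing using (AlmostCommutativeRing; fromCommutativeRing)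

  private variable p q r : ℚ

  ℚ-ring : AlmostCommutativeRing _ _
  ℚ-ring = fromCommutativeRing +-*-commutativeRing (λ x → dec⇒maybe (0ℚ ≟ x))

  0≤½ : 0ℚ ≤ ½
  0≤½ = ≤ᵇ⇒≤ tt

  0≤1 : 0ℚ ≤ 1ℚ
  0≤1 = ≤ᵇ⇒≤ tt

  0≤2 : 0ℚ ≤ 2
  0≤2 = ≤ᵇ⇒≤ tt

  0≤4 : 0ℚ ≤ 4
  0≤4 = ≤ᵇ⇒≤ tt

  0≤8 : 0ℚ ≤ 8
  0≤8 = ≤ᵇ⇒≤ tt

  0≤9 : 0ℚ ≤ 9
  0≤9 = ≤ᵇ⇒≤ tt

  p≤q⇒0≤q-p : p ≤ q → 0ℚ ≤ q - p
  p≤q⇒0≤q-p {p} {q} p≤q = subst (_≤ q - p) (+-inverseʳ p) (+-monoˡ-≤ (- p) p≤q)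

  p≤q⇒p-q≤0 : p ≤ q → p - q ≤ 0ℚ
  p≤q⇒p-q≤0 {p} {q} p≤q = subst (p - q ≤_) (+-inverseʳ q) (+-monoˡ-≤ (- q) p≤q)

  0≤q-p⇒p≤q : 0ℚ ≤ q - p → p ≤ q
  0≤q-p⇒p≤q {q} {p} 0≤q-p = subst₂ _≤_ (+-identityʳ p) (identity p q) (+-monoʳ-≤ p 0≤q-p)
    where
    identity : ∀ p q → p + (q - p) ≡ q
    identity = solve-∀ ℚ-ring

  ≤-by-difference : ∀ r → q - p ≡ r → 0ℚ ≤ r → p ≤ q
  ≤-by-difference r q-p≡r 0≤r = 0≤q-p⇒p≤q (subst (0ℚ ≤_) (sym q-p≡r) 0≤r)

  +-cancelˡ-≤ : ∀ r → r + p ≤ r + q → p ≤ q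
  +-cancelˡ-≤ {p} {q} r r+p≤r+q =
    0≤q-p⇒p≤q (subst (0ℚ ≤_) (identity r p q) (p≤q⇒0≤q-p r+p≤r+q))
    where
    identity : ∀ r p q → (r + q) - (r + p) ≡ q - p
    identity = solve-∀ ℚ-ring

  +-nonNeg : 0ℚ ≤ p → 0ℚ ≤ q → 0ℚ ≤ p + q
  +-nonNeg = +-mono-≤

  *-nonNeg : 0ℚ ≤ p → 0ℚ ≤ q → 0ℚ ≤ p * q
  *-nonNeg {p} {q} 0≤p 0≤q =
    nonNegative⁻¹ (p * q) {{nonNeg*nonNeg⇒nonNeg p {{nonNegative 0≤p}} q {{nonNegative 0≤q}}}}

  *-monoʳ-≤-by : 0ℚ ≤ r → p ≤ q → r * p ≤ r * q
  *-monoʳ-≤-by {r} 0≤r = *-monoˡ-≤-nonNeg r {{nonNegative 0≤r}}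

  2*p≤q⇒p≤½*q : 2 * p ≤ q → p ≤ ½ * q
  2*p≤q⇒p≤½*q {p} {q} 2p≤q = subst (_≤ ½ * q) (identity p) (*-monoˡ-≤-nonNeg ½ 2p≤q)
    where
    identity : ∀ p → ½ * (2 * p) ≡ p
    identity = solve-∀ ℚ-ring

  square-nonNeg : ∀ p → 0ℚ ≤ p * p
  square-nonNeg p with ≤-total 0ℚ p
  ... | inj₁ 0≤p = *-nonNeg 0≤p 0≤p
  ... | inj₂ p≤0 = subst (0ℚ ≤_) (identity p) (*-nonNeg 0≤-p 0≤-p)
    where
    0≤-p : 0ℚ ≤ - p
    0≤-p = neg-antimono-≤ p≤0
    identity : ∀ p → (- p) * (- p) ≡ p * p
    identity = solve-∀ ℚ-ring

  square-mono : 0ℚ ≤ p → p ≤ q → p * p ≤ q * q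
  square-mono {p} {q} 0≤p p≤q = ≤-by-difference ((q - p) * (q + p)) (identity p q)
    (*-nonNeg (p≤q⇒0≤q-p p≤q) (+-nonNeg (≤-trans 0≤p p≤q) 0≤p))
    where
    identity : ∀ p q → q * q - p * p ≡ (q - p) * (q + p)
    identity = solve-∀ ℚ-ring

  fromℕ : ℕ → ℚ
  fromℕ zero    = 0ℚ
  fromℕ (suc n) = 1ℚ + fromℕ n

  fromℕ-+ : ∀ m n → fromℕ (m Nat.+ n) ≡ fromℕ m + fromℕ n
  fromℕ-+ zero    n = sym (+-identityˡ (fromℕ n))
  fromℕ-+ (suc m) n = trans (cong (1ℚ +_) (fromℕ-+ m n)) (sym (+-assoc 1ℚ (fromℕ m) (fromℕ n)))

  fromℕ-* : ∀ m n → fromℕ (m Nat.* n) ≡ fromℕ m * fromℕ n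
  fromℕ-* zero    n = sym (*-zeroˡ (fromℕ n))
  fromℕ-* (suc m) n = begin
    fromℕ (n Nat.+ m Nat.* n)     ≡⟨ fromℕ-+ n (m Nat.* n) ⟩
    fromℕ n + fromℕ (m Nat.* n)   ≡⟨ cong (fromℕ n +_) (fromℕ-* m n) ⟩
    fromℕ n + fromℕ m * fromℕ n   ≡⟨ identity (fromℕ m) (fromℕ n) ⟩
    (1ℚ + fromℕ m) * fromℕ n      ∎
    where
    open ≡-Reasoning
    identity : ∀ a b → b + a * b ≡ (1ℚ + a) * b
    identity = solve-∀ ℚ-ring

  fromℕ-nonNeg : ∀ n → 0ℚ ≤ fromℕ n
  fromℕ-nonNeg zero    = ≤-refl
  fromℕ-nonNeg (suc n) = +-nonNeg 0≤1 (fromℕ-nonNeg n)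

  fromℕ-mono-≤ : ∀ {m n} → m Nat.≤ n → fromℕ m ≤ fromℕ n
  fromℕ-mono-≤ {n = n} z≤n = fromℕ-nonNeg n
  fromℕ-mono-≤ (s≤s m≤n)   = +-monoʳ-≤ 1ℚ (fromℕ-mono-≤ m≤n)

  fromℕ-cancel-≤ : ∀ m n → fromℕ m ≤ fromℕ n → m Nat.≤ n
  fromℕ-cancel-≤ zero    n       _       = z≤n
  fromℕ-cancel-≤ (suc m) zero    1+m≤0   =
    ⊥-elim (≤⇒≤ᵇ (≤-trans (+-monoʳ-≤ 1ℚ (fromℕ-nonNeg m)) 1+m≤0))
  fromℕ-cancel-≤ (suc m) (suc n) 1+m≤1+n = s≤s (fromℕ-cancel-≤ m n (+-cancelˡ-≤ 1ℚ 1+m≤1+n))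

module BellmanFunction where

  open import Data.Product using (_×_; _,_)
  open import Data.Rational
  open import Data.Rational.Properties
  open import Data.Sum using (_⊎_; inj₁; inj₂)
  open import Relation.Binary.PropositionalEquality
  open import Tactic.RingSolver using (solve-∀)
  open ℚ-Arithmetic

  private variable u a a′ d d′ p q : ℚ

  bellman : ℚ → ℚ
  bellman p = 2 * p * (1ℚ - p)

  step : ℚ → ℚ → ℚ → ℚ
  step u a d = a - ½ * (u * u * a) + u * d

  control : ℚ → ℚ
  control d = (2 * d) ⊓ 1ℚ

  _⁺ : ℚ → ℚ
  p ⁺ = p ⊔ 0ℚ

  edgeStep : ℚ → ℚ → ℚ
  edgeStep p q = step (control ((p - q) ⁺)) (bellman p) ((p - q) ⁺)

  Admissible : ℚ → Set
  Admissible u = 0ℚ ≤ u × u ≤ 1ℚ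

  control-admissible : 0ℚ ≤ d → Admissible (control d)
  control-admissible {d} 0≤d = ⊓-glb (*-nonNeg 0≤2 0≤d) 0≤1 , p⊓q≤q (2 * d) 1ℚ

  control-cases : ∀ d → control d ≡ 2 * d ⊎ (control d ≡ 1ℚ × 1ℚ ≤ 2 * d)
  control-cases d with ≤-total (2 * d) 1ℚ
  ... | inj₁ small = inj₁ (p≤q⇒p⊓q≡p small)
  ... | inj₂ large = inj₂ (p≥q⇒p⊓q≡q large , large)

  ⁺-nonNeg : ∀ p → 0ℚ ≤ p ⁺
  ⁺-nonNeg p = p≤q⊔p p 0ℚ

  ⁺-midpoint : ∀ p q → (½ * (p + q)) ⁺ ≤ ½ * (p ⁺ + q ⁺)
  ⁺-midpoint p q = ⊔-lub
    (*-monoˡ-≤-nonNeg ½ (+-mono-≤ (p≤p⊔q p 0ℚ) (p≤p⊔q q 0ℚ)))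
    (*-nonNeg 0≤½ (+-nonNeg (⁺-nonNeg p) (⁺-nonNeg q)))

  step-linear : ∀ u a a′ d d′ →
    step u (½ * (a + a′)) (½ * (d + d′)) ≡ ½ * (step u a d + step u a′ d′)
  step-linear = identity
    where
    identity : ∀ u a a′ d d′ →
      ½ * (a + a′) - ½ * (u * u * (½ * (a + a′))) + u * (½ * (d + d′)) ≡
      ½ * ((a - ½ * (u * u * a) + u * d) + (a′ - ½ * (u * u * a′) + u * d′))
    identity = solve-∀ ℚ-ring

  step-idle : ∀ a → step 0ℚ a 0ℚ ≡ a
  step-idle = identity
    where
    identity : ∀ a → a - ½ * (0ℚ * 0ℚ * a) + 0ℚ * 0ℚ ≡ a
    identity = solve-∀ ℚ-ring

  step-coefficient-nonNeg : Admissible u → 0ℚ ≤ 1ℚ - ½ * (u * u)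
  step-coefficient-nonNeg {u} (0≤u , u≤1) =
    ≤-by-difference (½ * ((1ℚ - u) * (1ℚ + u)) + ½) (identity u)
      (+-nonNeg (*-nonNeg 0≤½ (*-nonNeg (p≤q⇒0≤q-p u≤1) (+-nonNeg 0≤1 0≤u))) 0≤½)
    where
    identity : ∀ u → 1ℚ - ½ * (u * u) - 0ℚ ≡ ½ * ((1ℚ - u) * (1ℚ + u)) + ½
    identity = solve-∀ ℚ-ring

  step-mono : Admissible u → a ≤ a′ → d ≤ d′ → step u a d ≤ step u a′ d′
  step-mono {u} {a} {a′} {d} {d′} adm@(0≤u , _) a≤a′ d≤d′ =
    ≤-by-difference ((1ℚ - ½ * (u * u)) * (a′ - a) + u * (d′ - d)) (identity u a a′ d d′)
      (+-nonNeg (*-nonNeg (step-coefficient-nonNeg adm) (p≤q⇒0≤q-p a≤a′))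
                (*-nonNeg 0≤u (p≤q⇒0≤q-p d≤d′)))
    where
    identity : ∀ u a a′ d d′ →
      (a′ - ½ * (u * u * a′) + u * d′) - (a - ½ * (u * u * a) + u * d) ≡
      (1ℚ - ½ * (u * u)) * (a′ - a) + u * (d′ - d)
    identity = solve-∀ ℚ-ring

  step-nonNeg : Admissible u → 0ℚ ≤ a → 0ℚ ≤ d → 0ℚ ≤ step u a d
  step-nonNeg {u} {a} {d} adm@(0≤u , _) 0≤a 0≤d =
    ≤-by-difference ((1ℚ - ½ * (u * u)) * a + u * d) (identity u a d)
      (+-nonNeg (*-nonNeg (step-coefficient-nonNeg adm) 0≤a) (*-nonNeg 0≤u 0≤d))
    where
    identity : ∀ u a d → (a - ½ * (u * u * a) + u * d) - 0ℚ ≡ (1ℚ - ½ * (u * u)) * a + u * d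
    identity = solve-∀ ℚ-ring

  bellman-midpoint : ∀ p q → 2 * bellman (½ * (p + q)) ≡ bellman p + bellman q + (p - q) * (p - q)
  bellman-midpoint = identity
    where
    identity : ∀ p q →
      2 * (2 * (½ * (p + q)) * (1ℚ - ½ * (p + q))) ≡
      2 * p * (1ℚ - p) + 2 * q * (1ℚ - q) + (p - q) * (p - q)
    identity = solve-∀ ℚ-ring

  bellman-gain-small : ∀ p q → bellman p + (p - q) * (p - q) ≤ step (2 * (p - q)) (bellman p) (p - q)
  bellman-gain-small p q = ≤-by-difference (e * e) (identity p q) (square-nonNeg e)
    where
    e = (p - q) * (2 * p - 1ℚ)
    identity : ∀ p q →
      (2 * p * (1ℚ - p) - ½ * (2 * (p - q) * (2 * (p - q)) * (2 * p * (1ℚ - p))) + 2 * (p - q) * (p - q))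
        - (2 * p * (1ℚ - p) + (p - q) * (p - q)) ≡
      (p - q) * (2 * p - 1ℚ) * ((p - q) * (2 * p - 1ℚ))
    identity = solve-∀ ℚ-ring

  bellman-gain-large : ∀ p q → 0ℚ ≤ q → 1ℚ ≤ 2 * (p - q) →
    bellman p + (p - q) * (p - q) ≤ step 1ℚ (bellman p) (p - q)
  bellman-gain-large p q 0≤q 1≤2[p-q] =
    ≤-by-difference (q * ((2 * (p - q) - 1ℚ) + q)) (identity p q)
      (*-nonNeg 0≤q (+-nonNeg (p≤q⇒0≤q-p 1≤2[p-q]) 0≤q))
    where
    identity : ∀ p q →
      (2 * p * (1ℚ - p) - ½ * (1ℚ * 1ℚ * (2 * p * (1ℚ - p))) + 1ℚ * (p - q))
        - (2 * p * (1ℚ - p) + (p - q) * (p - q)) ≡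
      q * ((2 * (p - q) - 1ℚ) + q)
    identity = solve-∀ ℚ-ring

  bellman-gain : ∀ p q → 0ℚ ≤ q →
    bellman p + (p - q) * (p - q) ≤ step (control (p - q)) (bellman p) (p - q)
  bellman-gain p q 0≤q with control-cases (p - q)
  ... | inj₁ u≡2[p-q]         rewrite u≡2[p-q] = bellman-gain-small p q
  ... | inj₂ (u≡1 , 1≤2[p-q]) rewrite u≡1      = bellman-gain-large p q 0≤q 1≤2[p-q]

  edgeStep-descending : q ≤ p → edgeStep p q ≡ step (control (p - q)) (bellman p) (p - q)
  edgeStep-descending q≤p rewrite p≥q⇒p⊔q≡p (p≤q⇒0≤q-p q≤p) = refl

  edgeStep-ascending : p ≤ q → edgeStep p q ≡ bellman p
  edgeStep-ascending {p} p≤q rewrite p≤q⇒p⊔q≡q (p≤q⇒p-q≤0 p≤q) = step-idle (bellman p)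

  two-point-ordered : 0ℚ ≤ q → q ≤ p → 2 * bellman (½ * (p + q)) ≤ edgeStep p q + edgeStep q p
  two-point-ordered {q} {p} 0≤q q≤p = begin
    2 * bellman (½ * (p + q))                     ≡⟨ bellman-midpoint p q ⟩
    bellman p + bellman q + (p - q) * (p - q)     ≡⟨ swap (bellman p) (bellman q) ((p - q) * (p - q)) ⟩
    bellman p + (p - q) * (p - q) + bellman q     ≤⟨ +-monoˡ-≤ (bellman q) (bellman-gain p q 0≤q) ⟩
    step (control (p - q)) (bellman p) (p - q) + bellman q
      ≡⟨ cong₂ _+_ (edgeStep-descending {q} {p} q≤p) (edgeStep-ascending q≤p) ⟨
    edgeStep p q + edgeStep q p                   ∎
    where
    open ≤-Reasoning
    swap : ∀ a b c → a + b + c ≡ a + c + b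
    swap = solve-∀ ℚ-ring

  two-point : 0ℚ ≤ p → 0ℚ ≤ q → 2 * bellman (½ * (p + q)) ≤ edgeStep p q + edgeStep q p
  two-point {p} {q} 0≤p 0≤q with ≤-total q p
  ... | inj₁ q≤p = two-point-ordered 0≤q q≤p
  ... | inj₂ p≤q = subst₂ _≤_ (cong (λ s → 2 * bellman (½ * s)) (+-comm q p))
                              (+-comm (edgeStep q p) (edgeStep p q))
                              (two-point-ordered 0≤p p≤q)

module Cube where

  open import Data.Bool using (Bool; true; false; not)
  open import Data.Nat using (ℕ; zero; suc)
  open import Data.Product using (∃; _,_)
  open import Data.Rational
  open import Data.Rational.Properties
  open import Data.Sum using (inj₁; inj₂)
  open import Data.Vec using (Vec; []; _∷_; zipWith)
  open import Data.Vec.Relation.Unary.All using (All; []; _∷_)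
  open import Data.Vec.Relation.Binary.Pointwise.Inductive using (Pointwise; []; _∷_)
  open import Function using (_∘_)
  open import Relation.Binary.PropositionalEquality
  open import Tactic.RingSolver using (solve-∀)
  open ℚ-Arithmetic
  open BellmanFunction

  private variable
    m : ℕ
    a a′ p q : ℚ

  𝔼 : (Vec Bool m → ℚ) → ℚ
  𝔼 {zero}  h = h []
  𝔼 {suc m} h = ½ * (𝔼 (h ∘ (false ∷_)) + 𝔼 (h ∘ (true ∷_)))

  𝔼-+ : ∀ (g h : Vec Bool m → ℚ) → 𝔼 (λ x → g x + h x) ≡ 𝔼 g + 𝔼 h
  𝔼-+ {zero}  g h = refl
  𝔼-+ {suc m} g h = begin
    ½ * (𝔼 (λ x → g₀ x + h₀ x) + 𝔼 (λ x → g₁ x + h₁ x))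
      ≡⟨ cong₂ (λ s t → ½ * (s + t)) (𝔼-+ g₀ h₀) (𝔼-+ g₁ h₁) ⟩
    ½ * ((𝔼 g₀ + 𝔼 h₀) + (𝔼 g₁ + 𝔼 h₁))
      ≡⟨ identity (𝔼 g₀) (𝔼 h₀) (𝔼 g₁) (𝔼 h₁) ⟩
    ½ * (𝔼 g₀ + 𝔼 g₁) + ½ * (𝔼 h₀ + 𝔼 h₁) ∎
    where
    open ≡-Reasoning
    g₀ = g ∘ (false ∷_)
    g₁ = g ∘ (true ∷_)
    h₀ = h ∘ (false ∷_)
    h₁ = h ∘ (true ∷_)
    identity : ∀ a b c d → ½ * ((a + b) + (c + d)) ≡ ½ * (a + c) + ½ * (b + d)
    identity = solve-∀ ℚ-ring

  𝔼-* : ∀ c (h : Vec Bool m → ℚ) → 𝔼 (λ x → c * h x) ≡ c * 𝔼 h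
  𝔼-* {zero}  c h = refl
  𝔼-* {suc m} c h = begin
    ½ * (𝔼 (λ x → c * h₀ x) + 𝔼 (λ x → c * h₁ x)) ≡⟨ cong₂ (λ s t → ½ * (s + t)) (𝔼-* c h₀) (𝔼-* c h₁) ⟩
    ½ * (c * 𝔼 h₀ + c * 𝔼 h₁)                     ≡⟨ identity c (𝔼 h₀) (𝔼 h₁) ⟩
    c * (½ * (𝔼 h₀ + 𝔼 h₁))                       ∎
    where
    open ≡-Reasoning
    h₀ = h ∘ (false ∷_)
    h₁ = h ∘ (true ∷_)
    identity : ∀ c a b → ½ * (c * a + c * b) ≡ c * (½ * (a + b))
    identity = solve-∀ ℚ-ring

  𝔼-midpoint : ∀ (g h : Vec Bool m → ℚ) → 𝔼 (λ x → ½ * (g x + h x)) ≡ ½ * (𝔼 g + 𝔼 h)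
  𝔼-midpoint g h = trans (𝔼-* ½ (λ x → g x + h x)) (cong (½ *_) (𝔼-+ g h))

  𝔼-mono : ∀ {g h : Vec Bool m → ℚ} → (∀ x → g x ≤ h x) → 𝔼 g ≤ 𝔼 h
  𝔼-mono {zero}  g≤h = g≤h []
  𝔼-mono {suc m} g≤h =
    *-monoˡ-≤-nonNeg ½ (+-mono-≤ (𝔼-mono (g≤h ∘ (false ∷_))) (𝔼-mono (g≤h ∘ (true ∷_))))

  maximum : (Vec Bool m → ℚ) → ℚ
  maximum {zero}  h = h []
  maximum {suc m} h = maximum (h ∘ (false ∷_)) ⊔ maximum (h ∘ (true ∷_))

  ≤-maximum : ∀ (h : Vec Bool m → ℚ) x → h x ≤ maximum h
  ≤-maximum h []          = ≤-refl
  ≤-maximum h (false ∷ x) =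
    ≤-trans (≤-maximum (h ∘ (false ∷_)) x) (p≤p⊔q (maximum (h ∘ (false ∷_))) (maximum (h ∘ (true ∷_))))
  ≤-maximum h (true ∷ x)  =
    ≤-trans (≤-maximum (h ∘ (true ∷_)) x) (p≤q⊔p (maximum (h ∘ (false ∷_))) (maximum (h ∘ (true ∷_))))

  maximum-attained : ∀ (h : Vec Bool m → ℚ) → ∃ λ x → maximum h ≡ h x
  maximum-attained {zero}  h = [] , refl
  maximum-attained {suc m} h with ⊔-sel (maximum (h ∘ (false ∷_))) (maximum (h ∘ (true ∷_)))
  ... | inj₁ max≡max₀ = let x , eq = maximum-attained (h ∘ (false ∷_)) in false ∷ x , trans max≡max₀ eq
  ... | inj₂ max≡max₁ = let x , eq = maximum-attained (h ∘ (true ∷_))  in true ∷ x  , trans max≡max₁ eq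

  ∇⁺ : (Vec Bool m → ℚ) → Vec Bool m → Vec ℚ m
  ∇⁺ f []      = []
  ∇⁺ f (b ∷ x) = (f (b ∷ x) - f (not b ∷ x)) ⁺ ∷ ∇⁺ (f ∘ (b ∷_)) x

  midpoint : Vec ℚ m → Vec ℚ m → Vec ℚ m
  midpoint = zipWith (λ d d′ → ½ * (d + d′))

  ∇⁺-midpoint : ∀ (f g : Vec Bool m → ℚ) x →
    Pointwise _≤_ (∇⁺ (λ y → ½ * (f y + g y)) x) (midpoint (∇⁺ f x) (∇⁺ g x))
  ∇⁺-midpoint f g []      = []
  ∇⁺-midpoint f g (b ∷ x) =
    subst (_≤ ½ * (df ⁺ + dg ⁺)) (cong _⁺ (identity (f (b ∷ x)) (g (b ∷ x)) (f (not b ∷ x)) (g (not b ∷ x))))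
          (⁺-midpoint df dg)
    ∷ ∇⁺-midpoint (f ∘ (b ∷_)) (g ∘ (b ∷_)) x
    where
    df = f (b ∷ x) - f (not b ∷ x)
    dg = g (b ∷ x) - g (not b ∷ x)
    identity : ∀ a b c d → ½ * ((a - c) + (b - d)) ≡ ½ * (a + b) - ½ * (c + d)
    identity = solve-∀ ℚ-ring

  run : ℚ → Vec ℚ m → Vec ℚ m → ℚ
  run a []       []       = a
  run a (u ∷ us) (d ∷ ds) = run (step u a d) us ds

  run-linear : ∀ a a′ (us ds ds′ : Vec ℚ m) →
    run (½ * (a + a′)) us (midpoint ds ds′) ≡ ½ * (run a us ds + run a′ us ds′)
  run-linear a a′ []       []       []         = refl
  run-linear a a′ (u ∷ us) (d ∷ ds) (d′ ∷ ds′) =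
    trans (cong (λ s → run s us (midpoint ds ds′)) (step-linear u a a′ d d′))
          (run-linear (step u a d) (step u a′ d′) us ds ds′)

  run-mono : ∀ {us ds ds′ : Vec ℚ m} → All Admissible us → a ≤ a′ → Pointwise _≤_ ds ds′ →
    run a us ds ≤ run a′ us ds′
  run-mono []           a≤a′ []              = a≤a′
  run-mono (adm ∷ adms) a≤a′ (d≤d′ ∷ ds≤ds′) = run-mono adms (step-mono adm a≤a′ d≤d′) ds≤ds′

  run-two-point : ∀ {us ds ds₀ ds₁ : Vec ℚ m} → All Admissible us → 0ℚ ≤ p → 0ℚ ≤ q →
    Pointwise _≤_ ds (midpoint ds₀ ds₁) →
    run (bellman (½ * (p + q))) us ds ≤ ½ * (run (edgeStep p q) us ds₀ + run (edgeStep q p) us ds₁)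
  run-two-point {p = p} {q} {us} {ds} {ds₀} {ds₁} adms 0≤p 0≤q ds≤midpoint =
    subst (run (bellman (½ * (p + q))) us ds ≤_) (run-linear (edgeStep p q) (edgeStep q p) us ds₀ ds₁)
          (run-mono adms (2*p≤q⇒p≤½*q (two-point 0≤p 0≤q)) ds≤midpoint)

  record BellmanStrategy (f : Vec Bool m → ℚ) : Set where
    field
      controls   : Vec Bool m → Vec ℚ m
      admissible : ∀ x → All Admissible (controls x)
      bound      : bellman (𝔼 f) ≤ 𝔼 (λ x → run (bellman (f x)) (controls x) (∇⁺ f x))

  bellman-inequality : ∀ (f : Vec Bool m → ℚ) → (∀ x → 0ℚ ≤ f x) → BellmanStrategy f
  bellman-inequality {zero}  f _   = record { controls = λ _ → [] ; admissible = λ _ → [] ; bound = ≤-refl }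
  bellman-inequality {suc m} f 0≤f = record { controls = σ ; admissible = admissible ; bound = bound }
    where
    f₀ f₁ g : Vec Bool m → ℚ
    f₀ = f ∘ (false ∷_)
    f₁ = f ∘ (true ∷_)
    g x = ½ * (f₀ x + f₁ x)
    IH = bellman-inequality g (λ x → *-nonNeg 0≤½ (+-nonNeg (0≤f (false ∷ x)) (0≤f (true ∷ x))))
    open BellmanStrategy IH renaming (controls to σ′; admissible to admissible′; bound to bound′)
    σ : Vec Bool (suc m) → Vec ℚ (suc m)
    σ (b ∷ x) = control ((f (b ∷ x) - f (not b ∷ x)) ⁺) ∷ σ′ x
    admissible : ∀ x → All Admissible (σ x)
    admissible (b ∷ x) = control-admissible (⁺-nonNeg (f (b ∷ x) - f (not b ∷ x))) ∷ admissible′ x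
    run₀ run₁ : Vec Bool m → ℚ
    run₀ x = run (edgeStep (f₀ x) (f₁ x)) (σ′ x) (∇⁺ f₀ x)
    run₁ x = run (edgeStep (f₁ x) (f₀ x)) (σ′ x) (∇⁺ f₁ x)
    splitting : ∀ x → run (bellman (g x)) (σ′ x) (∇⁺ g x) ≤ ½ * (run₀ x + run₁ x)
    splitting x = run-two-point (admissible′ x) (0≤f (false ∷ x)) (0≤f (true ∷ x)) (∇⁺-midpoint f₀ f₁ x)
    -- By the definitions of run and 𝔼, the right-hand side is 𝔼 of the runs driven by σ.
    bound : bellman (𝔼 f) ≤ ½ * (𝔼 run₀ + 𝔼 run₁)
    bound = begin
      bellman (½ * (𝔼 f₀ + 𝔼 f₁))                    ≡⟨ cong bellman (𝔼-midpoint f₀ f₁) ⟨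
      bellman (𝔼 g)                                  ≤⟨ bound′ ⟩
      𝔼 (λ x → run (bellman (g x)) (σ′ x) (∇⁺ g x))  ≤⟨ 𝔼-mono splitting ⟩
      𝔼 (λ x → ½ * (run₀ x + run₁ x))                ≡⟨ 𝔼-midpoint run₀ run₁ ⟩
      ½ * (𝔼 run₀ + 𝔼 run₁)                          ∎
      where open ≤-Reasoning

module CubeCounting where

  open import Data.Bool using (Bool; true; false; not; if_then_else_; _∧_)
  open import Data.Bool.Properties using (∧-zeroʳ)
  open import Data.List using (List; []; _∷_; map; _++_)
  open import Data.Nat
  open import Data.Nat.Properties
  open import Data.Nat.Tactic.RingSolver using (solve-∀)
  open import Data.Vec using (Vec; []; _∷_)
  open import Function using (_∘_)
  open import Relation.Binary.PropositionalEquality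

  private variable
    X Y : Set
    m : ℕ

  𝟙 : Bool → ℕ
  𝟙 b = if b then 1 else 0

  𝟙≤1 : ∀ b → 𝟙 b ≤ 1
  𝟙≤1 true  = s≤s z≤n
  𝟙≤1 false = z≤n

  sumOver-cong : ∀ {g h : X → ℕ} → (∀ x → g x ≡ h x) → ∀ xs → sumOver g xs ≡ sumOver h xs
  sumOver-cong g≡h []       = refl
  sumOver-cong g≡h (x ∷ xs) = cong₂ _+_ (g≡h x) (sumOver-cong g≡h xs)

  sumOver-zero : ∀ (xs : List X) → sumOver (λ _ → 0) xs ≡ 0
  sumOver-zero []       = refl
  sumOver-zero (x ∷ xs) = sumOver-zero xs

  sumOver-+ : ∀ (g h : X → ℕ) xs → sumOver (λ x → g x + h x) xs ≡ sumOver g xs + sumOver h xs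
  sumOver-+ g h []       = refl
  sumOver-+ g h (x ∷ xs) rewrite sumOver-+ g h xs =
    interchange (g x) (h x) (sumOver g xs) (sumOver h xs)
    where
    interchange : ∀ a b c d → a + b + (c + d) ≡ a + c + (b + d)
    interchange = solve-∀

  sumOver-++ : ∀ (g : X → ℕ) xs ys → sumOver g (xs ++ ys) ≡ sumOver g xs + sumOver g ys
  sumOver-++ g []       ys = refl
  sumOver-++ g (x ∷ xs) ys =
    trans (cong (g x +_) (sumOver-++ g xs ys)) (sym (+-assoc (g x) (sumOver g xs) (sumOver g ys)))

  sumOver-map : ∀ (g : Y → ℕ) (h : X → Y) xs → sumOver g (map h xs) ≡ sumOver (g ∘ h) xs
  sumOver-map g h []       = refl
  sumOver-map g h (x ∷ xs) = cong (g (h x) +_) (sumOver-map g h xs)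

  sumOver-swap : ∀ (G : X → Y → ℕ) xs ys →
    sumOver (λ x → sumOver (G x) ys) xs ≡ sumOver (λ y → sumOver (λ x → G x y) xs) ys
  sumOver-swap G []       ys = sym (sumOver-zero ys)
  sumOver-swap G (x ∷ xs) ys =
    trans (cong (sumOver (G x) ys +_) (sumOver-swap G xs ys))
          (sym (sumOver-+ (G x) (λ y → sumOver (λ x′ → G x′ y) xs) ys))

  count≡sumOver : ∀ (p : X → Bool) xs → count p xs ≡ sumOver (𝟙 ∘ p) xs
  count≡sumOver p []       = refl
  count≡sumOver p (x ∷ xs) with p x
  ... | true  = cong suc (count≡sumOver p xs)
  ... | false = count≡sumOver p xs

  count-none : ∀ {p : X → Bool} → (∀ x → p x ≡ false) → ∀ xs → count p xs ≡ 0
  count-none none []                       = refl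
  count-none none (x ∷ xs) rewrite none x = count-none none xs

  sumOver-allVertices : ∀ (g : Vec Bool (suc m) → ℕ) →
    sumOver g (allVertices (suc m)) ≡
    sumOver (g ∘ (false ∷_)) (allVertices m) + sumOver (g ∘ (true ∷_)) (allVertices m)
  sumOver-allVertices {m} g =
    trans (sumOver-++ g (map (false ∷_) (allVertices m)) (map (true ∷_) (allVertices m)))
          (cong₂ _+_ (sumOver-map g (false ∷_) (allVertices m)) (sumOver-map g (true ∷_) (allVertices m)))

  count-allVertices : ∀ (p : Vec Bool (suc m) → Bool) →
    count p (allVertices (suc m)) ≡
    count (p ∘ (false ∷_)) (allVertices m) + count (p ∘ (true ∷_)) (allVertices m)
  count-allVertices {m} p = begin
    count p (allVertices (suc m))                  ≡⟨ count≡sumOver p (allVertices (suc m)) ⟩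
    sumOver (𝟙 ∘ p) (allVertices (suc m))          ≡⟨ sumOver-allVertices (𝟙 ∘ p) ⟩
    sumOver (𝟙 ∘ p₀) V + sumOver (𝟙 ∘ p₁) V        ≡⟨ cong₂ _+_ (count≡sumOver p₀ V) (count≡sumOver p₁ V) ⟨
    count p₀ V + count p₁ V                        ∎
    where
    open ≡-Reasoning
    V = allVertices m
    p₀ = p ∘ (false ∷_)
    p₁ = p ∘ (true ∷_)

  count-complement : ∀ (p : Vec Bool m → Bool) →
    count p (allVertices m) + count (not ∘ p) (allVertices m) ≡ 2 ^ m
  count-complement {zero}  p with p []
  ... | true  = refl
  ... | false = refl
  count-complement {suc m} p = begin
    count p V′ + count (not ∘ p) V′
      ≡⟨ cong₂ _+_ (count-allVertices p) (count-allVertices (not ∘ p)) ⟩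
    (count p₀ V + count p₁ V) + (count (not ∘ p₀) V + count (not ∘ p₁) V)
      ≡⟨ interchange (count p₀ V) (count p₁ V) (count (not ∘ p₀) V) (count (not ∘ p₁) V) ⟩
    (count p₀ V + count (not ∘ p₀) V) + (count p₁ V + count (not ∘ p₁) V)
      ≡⟨ cong₂ _+_ (count-complement p₀) (count-complement p₁) ⟩
    2 ^ m + 2 ^ m
      ≡⟨ cong (2 ^ m +_) (+-identityʳ (2 ^ m)) ⟨
    2 ^ suc m ∎
    where
    open ≡-Reasoning
    V = allVertices m
    V′ = allVertices (suc m)
    p₀ = p ∘ (false ∷_)
    p₁ = p ∘ (true ∷_)
    interchange : ∀ a b c d → (a + b) + (c + d) ≡ (a + c) + (b + d)
    interchange = solve-∀

  hamming-sym : ∀ (x y : Vec Bool m) → hamming x y ≡ hamming y x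
  hamming-sym []          []          = refl
  hamming-sym (false ∷ x) (false ∷ y) = hamming-sym x y
  hamming-sym (false ∷ x) (true ∷ y)  = cong suc (hamming-sym x y)
  hamming-sym (true ∷ x)  (false ∷ y) = cong suc (hamming-sym x y)
  hamming-sym (true ∷ x)  (true ∷ y)  = hamming-sym x y

  count-hamming-zero : ∀ (p : Vec Bool m → Bool) y →
    count (λ x → p x ∧ (hamming y x ≡ᵇ 0)) (allVertices m) ≡ 𝟙 (p y)
  count-hamming-zero {zero} p [] with p []
  ... | true  = refl
  ... | false = refl
  count-hamming-zero {suc m} p (false ∷ y)
    rewrite count-allVertices (λ x → p x ∧ (hamming (false ∷ y) x ≡ᵇ 0)) =
    trans (cong₂ _+_ (count-hamming-zero (p ∘ (false ∷_)) y)
                     (count-none (∧-zeroʳ ∘ p ∘ (true ∷_)) (allVertices m)))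
          (+-identityʳ (𝟙 (p (false ∷ y))))
  count-hamming-zero {suc m} p (true ∷ y)
    rewrite count-allVertices (λ x → p x ∧ (hamming (true ∷ y) x ≡ᵇ 0)) =
    cong₂ _+_ (count-none (∧-zeroʳ ∘ p ∘ (false ∷_)) (allVertices m)) (count-hamming-zero (p ∘ (true ∷_)) y)

  degree : (Vec Bool m → Bool) → Vec Bool m → ℕ
  degree p []      = 0
  degree p (b ∷ y) = 𝟙 (p (not b ∷ y)) + degree (p ∘ (b ∷_)) y

  degree≤dimension : ∀ (p : Vec Bool m → Bool) y → degree p y ≤ m
  degree≤dimension p []      = z≤n
  degree≤dimension p (b ∷ y) = +-mono-≤ (𝟙≤1 (p (not b ∷ y))) (degree≤dimension (p ∘ (b ∷_)) y)

  degree≡count : ∀ (p : Vec Bool m → Bool) y →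
    degree p y ≡ count (λ x → p x ∧ adjacentᵇ y x) (allVertices m)
  degree≡count p [] with p []
  ... | true  = refl
  ... | false = refl
  degree≡count {suc m} p (false ∷ y) rewrite count-allVertices (λ x → p x ∧ adjacentᵇ (false ∷ y) x) =
    trans (+-comm (𝟙 (p (true ∷ y))) (degree (p ∘ (false ∷_)) y))
          (cong₂ _+_ (degree≡count (p ∘ (false ∷_)) y) (sym (count-hamming-zero (p ∘ (true ∷_)) y)))
  degree≡count {suc m} p (true ∷ y) rewrite count-allVertices (λ x → p x ∧ adjacentᵇ (true ∷ y) x) =
    cong₂ _+_ (sym (count-hamming-zero (p ∘ (false ∷_)) y)) (degree≡count (p ∘ (true ∷_)) y)

  edgeAB≡sumOver-degree : ∀ n part →
    edgeAB n part ≡ sumOver (λ y → if isB (part y) then degree (isA ∘ part) y else 0) (allVertices n)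
  edgeAB≡sumOver-degree n part = begin
    edgeAB n part                                     ≡⟨ sumOver-cong (λ x → count≡sumOver (edge x) V) V ⟩
    sumOver (λ x → sumOver (λ y → 𝟙 (edge x y)) V) V  ≡⟨ sumOver-swap (λ x y → 𝟙 (edge x y)) V V ⟩
    sumOver (λ y → sumOver (λ x → 𝟙 (edge x y)) V) V  ≡⟨ sumOver-cong edges-into V ⟩
    sumOver (λ y → if isB (part y) then degree (isA ∘ part) y else 0) V ∎
    where
    open ≡-Reasoning
    V = allVertices n
    edge : Vec Bool n → Vec Bool n → Bool
    edge x y = isA (part x) ∧ (isB (part y) ∧ adjacentᵇ x y)
    edges-into : ∀ y → sumOver (λ x → 𝟙 (edge x y)) V ≡ (if isB (part y) then degree (isA ∘ part) y else 0)
    edges-into y with isB (part y)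
    ... | true  = begin
      sumOver (λ x → 𝟙 (isA (part x) ∧ adjacentᵇ x y)) V
        ≡⟨ sumOver-cong (λ x → cong (λ h → 𝟙 (isA (part x) ∧ (h ≡ᵇ 1))) (hamming-sym x y)) V ⟩
      sumOver (λ x → 𝟙 (isA (part x) ∧ adjacentᵇ y x)) V
        ≡⟨ count≡sumOver (λ x → isA (part x) ∧ adjacentᵇ y x) V ⟨
      count (λ x → isA (part x) ∧ adjacentᵇ y x) V
        ≡⟨ degree≡count (isA ∘ part) y ⟨
      degree (isA ∘ part) y ∎
    ... | false = trans (sumOver-cong (λ x → cong 𝟙 (∧-zeroʳ (isA (part x)))) V) (sumOver-zero V)

module UnitStep where

  open import Data.Product using (_,_)
  open import Data.Rational
  open import Data.Rational.Properties
  open import Relation.Binary.PropositionalEquality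
  open import Relation.Nullary using (yes; no)
  open import Tactic.RingSolver using (solve-∀)
  open ℚ-Arithmetic
  open BellmanFunction

  private variable u a b K : ℚ

  step-flat-≤ : 0ℚ ≤ a → step u a 0ℚ ≤ a
  step-flat-≤ {a} {u} 0≤a =
    ≤-by-difference (½ * (u * u * a)) (identity u a) (*-nonNeg 0≤½ (*-nonNeg (square-nonNeg u) 0≤a))
    where
    identity : ∀ u a → a - (a - ½ * (u * u * a) + u * 0ℚ) ≡ ½ * (u * u * a)
    identity = solve-∀ ℚ-ring

  step-unit-≤ : Admissible u → 0ℚ ≤ a → a ≤ b → step u a 1ℚ ≤ 1ℚ + b
  step-unit-≤ {u} {a} {b} (_ , u≤1) 0≤a a≤b =
    ≤-by-difference ((b - a) + ½ * (u * u * a) + (1ℚ - u)) (identity u a b)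
      (+-nonNeg (+-nonNeg (p≤q⇒0≤q-p a≤b) (*-nonNeg 0≤½ (*-nonNeg (square-nonNeg u) 0≤a)))
                (p≤q⇒0≤q-p u≤1))
    where
    identity : ∀ u a b →
      1ℚ + b - (a - ½ * (u * u * a) + u * 1ℚ) ≡ (b - a) + ½ * (u * u * a) + (1ℚ - u)
    identity = solve-∀ ℚ-ring

  step-unit-from-zero : Admissible u → 8 * (step u 0ℚ 1ℚ * step u 0ℚ 1ℚ) ≤ 9
  step-unit-from-zero {u} (0≤u , u≤1) = ≤-by-difference (1ℚ + 8 * (1ℚ - u * u)) (identity u)
    (+-nonNeg 0≤1 (*-nonNeg 0≤8 (p≤q⇒0≤q-p (square-mono 0≤u u≤1))))
    where
    identity : ∀ u → 9 - 8 * ((0ℚ - ½ * (u * u * 0ℚ) + u * 1ℚ) * (0ℚ - ½ * (u * u * 0ℚ) + u * 1ℚ)) ≡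
                     1ℚ + 8 * (1ℚ * 1ℚ - u * u)
    identity = solve-∀ ℚ-ring

  step-unit-when-a≤1 : Admissible u → 0ℚ ≤ a → a ≤ 1ℚ → step u a 1ℚ ≤ 3 ÷ 2
  step-unit-when-a≤1 {u} {a} (_ , u≤1) 0≤a a≤1 =
    ≤-by-difference ((1ℚ - u) * ((1ℚ - a) + ½ * a * (1ℚ - u)) + ½ * (1ℚ - a)) (identity u a)
      (+-nonNeg (*-nonNeg 0≤1-u (+-nonNeg 0≤1-a (*-nonNeg (*-nonNeg 0≤½ 0≤a) 0≤1-u))) (*-nonNeg 0≤½ 0≤1-a))
    where
    0≤1-u = p≤q⇒0≤q-p u≤1
    0≤1-a = p≤q⇒0≤q-p a≤1
    identity : ∀ u a → 3 ÷ 2 - (a - ½ * (u * u * a) + u * 1ℚ) ≡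
                       (1ℚ - u) * ((1ℚ - a) + ½ * a * (1ℚ - u)) + ½ * (1ℚ - a)
    identity = solve-∀ ℚ-ring

  2a*step-unit≤2a²+1 : ∀ u a → 2 * a * step u a 1ℚ ≤ 2 * (a * a) + 1ℚ
  2a*step-unit≤2a²+1 u a =
    ≤-by-difference ((1ℚ - a * u) * (1ℚ - a * u)) (identity u a) (square-nonNeg (1ℚ - a * u))
    where
    identity : ∀ u a →
      2 * (a * a) + 1ℚ - 2 * a * (a - ½ * (u * u * a) + u * 1ℚ) ≡ (1ℚ - a * u) * (1ℚ - a * u)
    identity = solve-∀ ℚ-ring

  step-unit-square-≤ : Admissible u → 1ℚ ≤ a →
    (2 * (a * a) + 1ℚ) * (2 * (a * a) + 1ℚ) ≤ 4 * (a * a) * b → step u a 1ℚ * step u a 1ℚ ≤ b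
  step-unit-square-≤ {u} {a} {b} adm 1≤a bound = *-cancelˡ-≤-pos (4 * (a * a)) {{positive 0<4a²}} (begin
    4 * (a * a) * (ℓ * ℓ)                    ≡⟨ identity a ℓ ⟩
    (2 * a * ℓ) * (2 * a * ℓ)                ≤⟨ square-mono 0≤2aℓ (2a*step-unit≤2a²+1 u a) ⟩
    (2 * (a * a) + 1ℚ) * (2 * (a * a) + 1ℚ)  ≤⟨ bound ⟩
    4 * (a * a) * b                          ∎)
    where
    open ≤-Reasoning
    ℓ = step u a 1ℚ
    0≤a = ≤-trans 0≤1 1≤a
    0≤2aℓ = *-nonNeg (*-nonNeg 0≤2 0≤a) (step-nonNeg adm 0≤a 0≤1)
    0<4a² : 0ℚ < 4 * (a * a)
    0<4a² = <-≤-trans (positive⁻¹ 4) (*-monoˡ-≤-nonNeg 4 (square-mono 0≤1 1≤a))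
    identity : ∀ a ℓ → 4 * (a * a) * (ℓ * ℓ) ≡ (2 * a * ℓ) * (2 * a * ℓ)
    identity = solve-∀ ℚ-ring

  step-unit-square-when-a²≥2 : Admissible u → 1ℚ ≤ a → 2 ≤ a * a →
    step u a 1ℚ * step u a 1ℚ ≤ a * a + 9 ÷ 8
  step-unit-square-when-a²≥2 {u} {a} adm 1≤a 2≤a² = step-unit-square-≤ adm 1≤a
    (≤-by-difference (½ * (a * a - 2)) (identity (a * a)) (*-nonNeg 0≤½ (p≤q⇒0≤q-p 2≤a²)))
    where
    identity : ∀ X → 4 * X * (X + 9 ÷ 8) - (2 * X + 1ℚ) * (2 * X + 1ℚ) ≡ ½ * (X - 2)
    identity = solve-∀ ℚ-ring

  step-unit-square-when-a²≤2 : Admissible u → 1ℚ ≤ a → a * a ≤ 2 →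
    step u a 1ℚ * step u a 1ℚ ≤ 27 ÷ 8
  step-unit-square-when-a²≤2 {u} {a} adm 1≤a a²≤2 = step-unit-square-≤ adm 1≤a
    (≤-by-difference ((2 - a * a) * (4 * (a * a - 1ℚ) + 2 + ½) + 2) (identity (a * a))
      (+-nonNeg (*-nonNeg (p≤q⇒0≤q-p a²≤2) (+-nonNeg (+-nonNeg (*-nonNeg 0≤4 0≤a²-1) 0≤2) 0≤½)) 0≤2))
    where
    0≤a²-1 : 0ℚ ≤ a * a - 1ℚ
    0≤a²-1 = p≤q⇒0≤q-p (square-mono 0≤1 1≤a)
    identity : ∀ X →
      4 * X * (27 ÷ 8) - (2 * X + 1ℚ) * (2 * X + 1ℚ) ≡ (2 - X) * (4 * (X - 1ℚ) + 2 + ½) + 2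
    identity = solve-∀ ℚ-ring

  step-unit-square-when-a≤1 : Admissible u → 0ℚ ≤ a → a ≤ 1ℚ → 1ℚ ≤ K →
    8 * (step u a 1ℚ * step u a 1ℚ) ≤ 9 * (1ℚ + K)
  step-unit-square-when-a≤1 {u} {a} {K} adm 0≤a a≤1 1≤K = begin
    8 * (step u a 1ℚ * step u a 1ℚ)
      ≤⟨ *-monoˡ-≤-nonNeg 8 (square-mono (step-nonNeg adm 0≤a 0≤1) (step-unit-when-a≤1 adm 0≤a a≤1)) ⟩
    8 * (3 ÷ 2 * (3 ÷ 2))
      ≤⟨ ≤-by-difference (9 * (K - 1ℚ)) (identity K) (*-nonNeg 0≤9 (p≤q⇒0≤q-p 1≤K)) ⟩
    9 * (1ℚ + K) ∎
    where
    open ≤-Reasoning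
    identity : ∀ K → 9 * (1ℚ + K) - 8 * (3 ÷ 2 * (3 ÷ 2)) ≡ 9 * (K - 1ℚ)
    identity = solve-∀ ℚ-ring

  step-unit-square-when-a≥1 : Admissible u → 1ℚ ≤ a → 8 * (a * a) ≤ 9 * K → 2 ≤ K →
    8 * (step u a 1ℚ * step u a 1ℚ) ≤ 9 * (1ℚ + K)
  step-unit-square-when-a≥1 {u} {a} {K} adm 1≤a 8a²≤9K 2≤K with 2 ≤? a * a
  ... | yes 2≤a² = begin
    8 * (step u a 1ℚ * step u a 1ℚ) ≤⟨ *-monoˡ-≤-nonNeg 8 (step-unit-square-when-a²≥2 adm 1≤a 2≤a²) ⟩
    8 * (a * a + 9 ÷ 8)             ≡⟨ identity (a * a) ⟩
    8 * (a * a) + 9                 ≤⟨ +-monoˡ-≤ 9 8a²≤9K ⟩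
    9 * K + 9                       ≡⟨ identity′ K ⟩
    9 * (1ℚ + K)                    ∎
    where
    open ≤-Reasoning
    identity : ∀ X → 8 * (X + 9 ÷ 8) ≡ 8 * X + 9
    identity = solve-∀ ℚ-ring
    identity′ : ∀ K → 9 * K + 9 ≡ 9 * (1ℚ + K)
    identity′ = solve-∀ ℚ-ring
  ... | no 2≰a² = begin
    8 * (step u a 1ℚ * step u a 1ℚ)
      ≤⟨ *-monoˡ-≤-nonNeg 8 (step-unit-square-when-a²≤2 adm 1≤a (<⇒≤ (≰⇒> 2≰a²))) ⟩
    8 * (27 ÷ 8)
      ≤⟨ ≤-by-difference (9 * (K - 2)) (identity K) (*-nonNeg 0≤9 (p≤q⇒0≤q-p 2≤K)) ⟩
    9 * (1ℚ + K) ∎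
    where
    open ≤-Reasoning
    identity : ∀ K → 9 * (1ℚ + K) - 8 * (27 ÷ 8) ≡ 9 * (K - 2)
    identity = solve-∀ ℚ-ring

module IndicatorRuns where

  open import Data.Bool using (Bool; true; false; not)
  import Data.Nat as Nat
  open Nat using (ℕ; zero; suc; z≤n; s≤s)
  import Data.Nat.Properties as Natₚ
  open import Data.Rational
  open import Data.Rational.Properties
  open import Data.Vec using (Vec; []; _∷_)
  open import Data.Vec.Relation.Unary.All using (All; []; _∷_)
  open import Function using (_∘_)
  open import Relation.Binary.PropositionalEquality
  open import Relation.Nullary using (yes; no)
  open ℚ-Arithmetic
  open BellmanFunction
  open Cube
  open CubeCounting using (𝟙; degree)
  open UnitStep

  private variable
    m k : ℕ
    u a : ℚ

  -- 9/8 is the largest c with √(c n) ≤ n^β for all n ≥ 2 (equality at n = 2).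
  record Bounded (a : ℚ) (k : ℕ) : Set where
    constructor bounded
    field
      0≤value        : 0ℚ ≤ a
      value≤count    : a ≤ fromℕ k
      8value²≤9count : 8 * (a * a) ≤ 9 * fromℕ k

  bounded-mono : ∀ {k k′} → k Nat.≤ k′ → Bounded a k → Bounded a k′
  bounded-mono k≤k′ (bounded 0≤a a≤k 8a²≤9k) =
    bounded 0≤a (≤-trans a≤k (fromℕ-mono-≤ k≤k′)) (≤-trans 8a²≤9k (*-monoˡ-≤-nonNeg 9 (fromℕ-mono-≤ k≤k′)))

  step-flat-bounded : Admissible u → Bounded a k → Bounded (step u a 0ℚ) k
  step-flat-bounded {u} {a} adm (bounded 0≤a a≤k 8a²≤9k) =
    bounded 0≤ℓ (≤-trans ℓ≤a a≤k) (≤-trans (*-monoˡ-≤-nonNeg 8 (square-mono 0≤ℓ ℓ≤a)) 8a²≤9k)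
    where
    0≤ℓ : 0ℚ ≤ step u a 0ℚ
    0≤ℓ = step-nonNeg adm 0≤a ≤-refl
    ℓ≤a : step u a 0ℚ ≤ a
    ℓ≤a = step-flat-≤ {u = u} 0≤a

  step-unit-square-bounded : Admissible u → Bounded a k →
    8 * (step u a 1ℚ * step u a 1ℚ) ≤ 9 * fromℕ (suc k)
  step-unit-square-bounded {k = zero} adm (bounded 0≤a a≤0 _) with ≤-antisym a≤0 0≤a
  ... | refl = step-unit-from-zero adm
  step-unit-square-bounded {k = suc zero} adm (bounded 0≤a a≤1 _) =
    step-unit-square-when-a≤1 adm 0≤a a≤1 ≤-refl
  step-unit-square-bounded {a = a} {k = suc (suc k)} adm (bounded 0≤a _ 8a²≤9k) with a ≤? 1ℚ
  ... | yes a≤1 = step-unit-square-when-a≤1 adm 0≤a a≤1 (fromℕ-mono-≤ {n = suc (suc k)} (s≤s z≤n))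
  ... | no a≰1  =
    step-unit-square-when-a≥1 adm (<⇒≤ (≰⇒> a≰1)) 8a²≤9k (fromℕ-mono-≤ {n = suc (suc k)} (s≤s (s≤s z≤n)))

  step-unit-bounded : Admissible u → Bounded a k → Bounded (step u a 1ℚ) (suc k)
  step-unit-bounded adm a-bounded@(bounded 0≤a a≤k _) =
    bounded (step-nonNeg adm 0≤a 0≤1) (step-unit-≤ adm 0≤a a≤k) (step-unit-square-bounded adm a-bounded)

  indicatorᶜ : (Vec Bool m → Bool) → Vec Bool m → ℚ
  indicatorᶜ p x = fromℕ (𝟙 (not (p x)))

  run-inside : ∀ (p : Vec Bool m → Bool) y {us} → All Admissible us → p y ≡ true →
    Bounded a k → Bounded (run a us (∇⁺ (indicatorᶜ p) y)) k
  run-inside p []      []           _     a-bounded = a-bounded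
  run-inside p (b ∷ y) (adm ∷ adms) y∈p a-bounded rewrite y∈p with p (not b ∷ y)
  ... | true  = run-inside (p ∘ (b ∷_)) y adms y∈p (step-flat-bounded adm a-bounded)
  ... | false = run-inside (p ∘ (b ∷_)) y adms y∈p (step-flat-bounded adm a-bounded)

  run-outside : ∀ (p : Vec Bool m → Bool) y {us} → All Admissible us → p y ≡ false →
    Bounded a k → Bounded (run a us (∇⁺ (indicatorᶜ p) y)) (k Nat.+ degree p y)
  run-outside {k = k} p []      []           _     a-bounded =
    subst (Bounded _) (sym (Natₚ.+-identityʳ k)) a-bounded
  run-outside {k = k} p (b ∷ y) (adm ∷ adms) y∉p a-bounded rewrite y∉p with p (not b ∷ y)
  ... | true  = subst (Bounded _) (sym (Natₚ.+-suc k _))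
                      (run-outside (p ∘ (b ∷_)) y adms y∉p (step-unit-bounded adm a-bounded))
  ... | false = run-outside (p ∘ (b ∷_)) y adms y∉p (step-flat-bounded adm a-bounded)

module EdgeBoundary where

  open import Data.Bool using (Bool; true; false; not; if_then_else_)
  import Data.Nat as Nat
  open Nat using (zero; suc; _^_; _∸_; z≤n)
  import Data.Nat.Properties as Natₚ
  open import Data.Product using (_,_)
  open import Data.Rational
  open import Data.Rational.Properties
  open import Data.Vec using (Vec; []; _∷_)
  open import Function using (_∘_)
  open import Relation.Binary.PropositionalEquality
  open import Relation.Nullary using (yes; no)
  open import Tactic.RingSolver using (solve-∀)
  open ℚ-Arithmetic
  open BellmanFunction
  open Cube
  open CubeCounting
  open IndicatorRuns

  private variable m : ℕ

  𝔼-fromℕ : ∀ (g : Vec Bool m → ℕ) → fromℕ (2 ^ m) * 𝔼 (fromℕ ∘ g) ≡ fromℕ (sumOver g (allVertices m))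
  𝔼-fromℕ {zero}  g = trans (*-identityˡ (fromℕ (g []))) (cong fromℕ (sym (Natₚ.+-identityʳ (g []))))
  𝔼-fromℕ {suc m} g = begin
    fromℕ (2 Nat.* 2 ^ m) * (½ * (E₀ + E₁))  ≡⟨ cong (_* (½ * (E₀ + E₁))) (fromℕ-* 2 (2 ^ m)) ⟩
    2 * N * (½ * (E₀ + E₁))                  ≡⟨ identity N E₀ E₁ ⟩
    N * E₀ + N * E₁                          ≡⟨ cong₂ _+_ (𝔼-fromℕ g₀) (𝔼-fromℕ g₁) ⟩
    fromℕ (sumOver g₀ V) + fromℕ (sumOver g₁ V) ≡⟨ fromℕ-+ (sumOver g₀ V) (sumOver g₁ V) ⟨
    fromℕ (sumOver g₀ V Nat.+ sumOver g₁ V)  ≡⟨ cong fromℕ (sumOver-allVertices g) ⟨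
    fromℕ (sumOver g (allVertices (suc m)))  ∎
    where
    open ≡-Reasoning
    N = fromℕ (2 ^ m)
    V = allVertices m
    g₀ = g ∘ (false ∷_)
    g₁ = g ∘ (true ∷_)
    E₀ = 𝔼 (fromℕ ∘ g₀)
    E₁ = 𝔼 (fromℕ ∘ g₁)
    identity : ∀ N a b → 2 * N * (½ * (a + b)) ≡ N * a + N * b
    identity = solve-∀ ℚ-ring

  bellman-balanced : ∀ N E c → N * E ≡ c → 2 * c ≡ N → N * bellman E ≡ c
  bellman-balanced N E c NE≡c 2c≡N = begin
    N * (2 * E * (1ℚ - E))         ≡⟨ identity N E ⟩
    2 * (N * E) - 2 * (N * E) * E  ≡⟨ cong (λ t → 2 * t - 2 * t * E) NE≡c ⟩
    2 * c - 2 * c * E              ≡⟨ cong (λ t → 2 * c - t * E) 2c≡N ⟩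
    2 * c - N * E                  ≡⟨ cong (λ t → 2 * c - t) NE≡c ⟩
    2 * c - c                      ≡⟨ identity′ c ⟩
    c                              ∎
    where
    open ≡-Reasoning
    identity : ∀ N E → N * (2 * E * (1ℚ - E)) ≡ 2 * (N * E) - 2 * (N * E) * E
    identity = solve-∀ ℚ-ring
    identity′ : ∀ c → 2 * c - c ≡ c
    identity′ = solve-∀ ℚ-ring

  bellman-fromℕ-𝟙 : ∀ b → bellman (fromℕ (𝟙 b)) ≡ 0ℚ
  bellman-fromℕ-𝟙 true  = refl
  bellman-fromℕ-𝟙 false = refl

  squared-bound : ∀ a e w n M → fromℕ a ≤ fromℕ e + M * fromℕ w → 0ℚ ≤ M → 8 * (M * M) ≤ 9 * fromℕ n →
    8 Nat.* ((a ∸ e) Nat.* (a ∸ e)) Nat.≤ 9 Nat.* n Nat.* (w Nat.* w)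
  squared-bound a e w n M a≤e+Mw 0≤M 8M²≤9n with e Nat.≤? a
  ... | no e≰a rewrite Natₚ.m≤n⇒m∸n≡0 (Natₚ.<⇒≤ (Natₚ.≰⇒> e≰a)) = z≤n
  ... | yes e≤a = fromℕ-cancel-≤ _ _ (begin
    fromℕ (8 Nat.* (D Nat.* D))  ≡⟨ trans (fromℕ-* 8 (D Nat.* D)) (cong (8 *_) (fromℕ-* D D)) ⟩
    8 * (fromℕ D * fromℕ D)      ≤⟨ *-monoˡ-≤-nonNeg 8 (square-mono (fromℕ-nonNeg D) D≤Mw) ⟩
    8 * ((M * W) * (M * W))      ≡⟨ identity M W ⟩
    (W * W) * (8 * (M * M))      ≤⟨ *-monoʳ-≤-by (square-nonNeg W) 8M²≤9n ⟩
    (W * W) * (9 * fromℕ n)      ≡⟨ identity′ W (fromℕ n) ⟩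
    9 * fromℕ n * (W * W)
      ≡⟨ trans (fromℕ-* (9 Nat.* n) (w Nat.* w)) (cong₂ _*_ (fromℕ-* 9 n) (fromℕ-* w w)) ⟨
    fromℕ (9 Nat.* n Nat.* (w Nat.* w)) ∎)
    where
    open ≤-Reasoning
    D = a ∸ e
    W = fromℕ w
    a≡e+D : fromℕ a ≡ fromℕ e + fromℕ D
    a≡e+D = trans (cong fromℕ (sym (Natₚ.m+[n∸m]≡n e≤a))) (fromℕ-+ e D)
    D≤Mw : fromℕ D ≤ M * W
    D≤Mw = +-cancelˡ-≤ (fromℕ e) (subst (_≤ fromℕ e + M * W) a≡e+D a≤e+Mw)
    identity : ∀ M W → 8 * ((M * W) * (M * W)) ≡ (W * W) * (8 * (M * M))
    identity = solve-∀ ℚ-ring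
    identity′ : ∀ W N → (W * W) * (9 * N) ≡ 9 * N * (W * W)
    identity′ = solve-∀ ℚ-ring

  module _ {n : ℕ} (part : Vec Bool n → Part) where

    private
      inA : Vec Bool n → Bool
      inA = isA ∘ part

      f : Vec Bool n → ℚ
      f = indicatorᶜ inA

      strategy : BellmanStrategy f
      strategy = bellman-inequality f (λ x → fromℕ-nonNeg (𝟙 (not (inA x))))

      open BellmanStrategy strategy

    Φ : Vec Bool n → ℚ
    Φ y = run (bellman (f y)) (controls y) (∇⁺ f y)

    private
      start-bounded : ∀ y → Bounded (bellman (f y)) 0
      start-bounded y =
        subst (λ a → Bounded a 0) (sym (bellman-fromℕ-𝟙 (not (inA y)))) (bounded ≤-refl ≤-refl ≤-refl)

      Φ-inside : ∀ y → inA y ≡ true → Bounded (Φ y) 0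
      Φ-inside y y∈A = run-inside inA y (admissible y) y∈A (start-bounded y)

      Φ-outside : ∀ y → inA y ≡ false → Bounded (Φ y) (degree inA y)
      Φ-outside y y∉A = run-outside inA y (admissible y) y∉A (start-bounded y)

    Φ-bounded : ∀ y → Bounded (Φ y) n
    Φ-bounded y = by-membership (inA y) refl
      where
      by-membership : ∀ b → inA y ≡ b → Bounded (Φ y) n
      by-membership true  y∈A = bounded-mono z≤n (Φ-inside y y∈A)
      by-membership false y∉A = bounded-mono (degree≤dimension inA y) (Φ-outside y y∉A)

    partCost : Part → Vec Bool n → ℚ
    partCost π y = fromℕ (if isB π then degree inA y else 0) + maximum Φ * fromℕ (𝟙 (isW π))

    Φ≤partCost : ∀ y → Φ y ≤ partCost (part y) y
    Φ≤partCost y = by-part (part y) refl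
      where
      M = maximum Φ
      by-part : ∀ π → part y ≡ π → Φ y ≤ partCost π y
      by-part partA y∈A = ≤-trans (Bounded.value≤count (Φ-inside y (cong isA y∈A)))
                                  (≤-reflexive (sym (identity M)))
        where
        identity : ∀ M → 0ℚ + M * 0ℚ ≡ 0ℚ
        identity = solve-∀ ℚ-ring
      by-part partB y∈B = ≤-trans (Bounded.value≤count (Φ-outside y (cong isA y∈B)))
                                  (≤-reflexive (sym (identity (fromℕ (degree inA y)) M)))
        where
        identity : ∀ d M → d + M * 0ℚ ≡ d
        identity = solve-∀ ℚ-ring
      by-part partW _   = ≤-trans (≤-maximum Φ y) (≤-reflexive (sym (identity M)))
        where
        identity : ∀ M → 0ℚ + M * 1ℚ ≡ M
        identity = solve-∀ ℚ-ring

    total-partCost : fromℕ (2 ^ n) * 𝔼 (λ y → partCost (part y) y) ≡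
                     fromℕ (edgeAB n part) + maximum Φ * fromℕ (cardW n part)
    total-partCost = begin
      N * 𝔼 (λ y → fromℕ (onB y) + M * fromℕ (onW y))
        ≡⟨ cong (N *_) (trans (𝔼-+ (fromℕ ∘ onB) (λ y → M * fromℕ (onW y)))
                              (cong (𝔼 (fromℕ ∘ onB) +_) (𝔼-* M (fromℕ ∘ onW)))) ⟩
      N * (𝔼 (fromℕ ∘ onB) + M * 𝔼 (fromℕ ∘ onW))
        ≡⟨ identity N (𝔼 (fromℕ ∘ onB)) M (𝔼 (fromℕ ∘ onW)) ⟩
      N * 𝔼 (fromℕ ∘ onB) + M * (N * 𝔼 (fromℕ ∘ onW))
        ≡⟨ cong₂ (λ s t → s + M * t) (𝔼-fromℕ onB) (𝔼-fromℕ onW) ⟩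
      fromℕ (sumOver onB V) + M * fromℕ (sumOver onW V)
        ≡⟨ cong₂ (λ s t → fromℕ s + M * fromℕ t)
                 (edgeAB≡sumOver-degree n part) (count≡sumOver (isW ∘ part) V) ⟨
      fromℕ (edgeAB n part) + M * fromℕ (cardW n part) ∎
      where
      open ≡-Reasoning
      N = fromℕ (2 ^ n)
      M = maximum Φ
      V = allVertices n
      onB onW : Vec Bool n → ℕ
      onB y = if isB (part y) then degree inA y else 0
      onW y = 𝟙 (isW (part y))
      identity : ∀ N a M b → N * (a + M * b) ≡ N * a + M * (N * b)
      identity = solve-∀ ℚ-ring

    edge-boundary : fromℕ (2 ^ n) * bellman (𝔼 f) ≤ fromℕ (edgeAB n part) + maximum Φ * fromℕ (cardW n part)
    edge-boundary = begin
      N * bellman (𝔼 f)                        ≤⟨ *-monoʳ-≤-by 0≤N bound ⟩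
      N * 𝔼 Φ                                  ≤⟨ *-monoʳ-≤-by 0≤N (𝔼-mono Φ≤partCost) ⟩
      N * 𝔼 (λ y → partCost (part y) y)        ≡⟨ total-partCost ⟩
      fromℕ (edgeAB n part) + maximum Φ * fromℕ (cardW n part) ∎
      where
      open ≤-Reasoning
      N = fromℕ (2 ^ n)
      0≤N = fromℕ-nonNeg (2 ^ n)

    balanced-edge-boundary : 2 Nat.* cardA n part ≡ 2 ^ n →
      fromℕ (cardA n part) ≤ fromℕ (edgeAB n part) + maximum Φ * fromℕ (cardW n part)
    balanced-edge-boundary balanced =
      subst (_≤ fromℕ (edgeAB n part) + maximum Φ * fromℕ (cardW n part))
            (bellman-balanced N (𝔼 f) (fromℕ |A|) N𝔼f≡|A| 2|A|≡N)
            edge-boundary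
      where
      N = fromℕ (2 ^ n)
      V = allVertices n
      |A| = cardA n part
      |Aᶜ|≡|A| : count (not ∘ inA) V ≡ |A|
      |Aᶜ|≡|A| = Natₚ.+-cancelˡ-≡ |A| _ _
        (trans (count-complement inA) (trans (sym balanced) (cong (|A| Nat.+_) (Natₚ.+-identityʳ |A|))))
      N𝔼f≡|A| : N * 𝔼 f ≡ fromℕ |A|
      N𝔼f≡|A| = trans (𝔼-fromℕ (𝟙 ∘ not ∘ inA))
                      (cong fromℕ (trans (sym (count≡sumOver (not ∘ inA) V)) |Aᶜ|≡|A|))
      2|A|≡N : 2 * fromℕ |A| ≡ N
      2|A|≡N = trans (sym (fromℕ-* 2 |A|)) (cong fromℕ balanced)

  balanced-squared-bound : ∀ {n} (part : Vec Bool n → Part) → 2 Nat.* cardA n part ≡ 2 ^ n →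
    let D = cardA n part ∸ edgeAB n part ; w = cardW n part in
    8 Nat.* (D Nat.* D) Nat.≤ 9 Nat.* n Nat.* (w Nat.* w)
  balanced-squared-bound {n} part balanced with maximum-attained (Φ part)
  ... | y , max≡Φy = squared-bound (cardA n part) (edgeAB n part) (cardW n part) n (maximum (Φ part))
    (balanced-edge-boundary part balanced)
    (subst (0ℚ ≤_) (sym max≡Φy) (Bounded.0≤value (Φ-bounded part y)))
    (subst (λ M → 8 * (M * M) ≤ 9 * fromℕ n) (sym max≡Φy) (Bounded.8value²≤9count (Φ-bounded part y)))

module Exponents where

  open import Data.Empty using (⊥-elim)
  open import Data.Nat
  open import Data.Nat.Properties
  open import Data.Nat.Tactic.RingSolver using (solve-∀)
  open import Relation.Binary.PropositionalEquality
  open import Relation.Nullary using (yes; no)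

  ^-distribʳ-* : ∀ a b s → (a * b) ^ s ≡ a ^ s * b ^ s
  ^-distribʳ-* a b zero    = refl
  ^-distribʳ-* a b (suc s) rewrite ^-distribʳ-* a b s = interchange a b (a ^ s) (b ^ s)
    where
    interchange : ∀ a b x y → a * b * (x * y) ≡ a * x * (b * y)
    interchange = solve-∀

  m*m≤n*n⇒m≤n : ∀ m n → m * m ≤ n * n → m ≤ n
  m*m≤n*n⇒m≤n m n m²≤n² with m ≤? n
  ... | yes m≤n = m≤n
  ... | no m≰n  = ⊥-elim (<⇒≱ (*-mono-< (≰⇒> m≰n) (≰⇒> m≰n)) m²≤n²)

  2^-cancel-< : ∀ a b → 2 ^ a < 2 ^ b → a < b
  2^-cancel-< a b 2^a<2^b with a <? b
  ... | yes a<b = a<b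
  ... | no a≮b  = ⊥-elim (<⇒≱ 2^a<2^b (^-monoʳ-≤ 2 (≮⇒≥ a≮b)))

  exponent-bound : ∀ r s → 3 ^ s < 2 ^ (r + s) → s ≤ r + r
  exponent-bound r s 3^s<2^[r+s] = <⇒≤ (+-cancelˡ-< (s + s) s (r + r)
    (subst₂ _<_ (identity s) (identity′ r s) (2^-cancel-< (3 * s) ((r + s) + (r + s)) powers)))
    where
    open ≤-Reasoning
    powers : 2 ^ (3 * s) < 2 ^ ((r + s) + (r + s))
    powers = begin-strict
      2 ^ (3 * s)                ≡⟨ ^-*-assoc 2 3 s ⟨
      8 ^ s                      ≤⟨ ^-monoˡ-≤ s (≤ᵇ⇒≤ 8 9 _) ⟩
      9 ^ s                      ≡⟨ ^-distribʳ-* 3 3 s ⟩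
      3 ^ s * 3 ^ s              <⟨ *-mono-< 3^s<2^[r+s] 3^s<2^[r+s] ⟩
      2 ^ (r + s) * 2 ^ (r + s)  ≡⟨ ^-distribˡ-+-* 2 (r + s) (r + s) ⟨
      2 ^ ((r + s) + (r + s))    ∎
    identity : ∀ s → 3 * s ≡ (s + s) + s
    identity = solve-∀
    identity′ : ∀ r s → (r + s) + (r + s) ≡ (s + s) + (r + r)
    identity′ = solve-∀

  2^b*n^a≤2^a*n^b : ∀ {n a b} → 2 ≤ n → a ≤ b → 2 ^ b * n ^ a ≤ 2 ^ a * n ^ b
  2^b*n^a≤2^a*n^b {n} {a} {b} 2≤n a≤b =
    subst (λ b → 2 ^ b * n ^ a ≤ 2 ^ a * n ^ b) (m+[n∸m]≡n a≤b) (begin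
      2 ^ (a + t) * n ^ a      ≡⟨ cong (_* n ^ a) (^-distribˡ-+-* 2 a t) ⟩
      2 ^ a * 2 ^ t * n ^ a    ≤⟨ *-monoˡ-≤ (n ^ a) (*-monoʳ-≤ (2 ^ a) (^-monoˡ-≤ t 2≤n)) ⟩
      2 ^ a * n ^ t * n ^ a    ≡⟨ rearrange (2 ^ a) (n ^ t) (n ^ a) ⟩
      2 ^ a * (n ^ a * n ^ t)  ≡⟨ cong (2 ^ a *_) (^-distribˡ-+-* n a t) ⟨
      2 ^ a * n ^ (a + t)      ∎)
    where
    open ≤-Reasoning
    t = b ∸ a
    rearrange : ∀ x y z → x * y * z ≡ x * (z * y)
    rearrange = solve-∀

  -- (9n/8)^s ≤ n^(2r) says √(9n/8) ≤ n^(r/s). At n = 2 this is 3/2 < 2^(r/s), and from there it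
  -- propagates to all n ≥ 2 because r/s ≥ 1/2.
  nine-eighths-bound : ∀ {n} r s → 2 ≤ n → 3 ^ s < 2 ^ (r + s) → 9 ^ s * n ^ s ≤ 8 ^ s * n ^ (r + r)
  nine-eighths-bound {n} r s 2≤n 3^s<2^[r+s] = begin
    9 ^ s * n ^ s
      ≡⟨ cong (_* n ^ s) (^-distribʳ-* 3 3 s) ⟩
    3 ^ s * 3 ^ s * n ^ s
      ≤⟨ *-monoˡ-≤ (n ^ s) (*-mono-≤ (<⇒≤ 3^s<2^[r+s]) (<⇒≤ 3^s<2^[r+s])) ⟩
    2 ^ (r + s) * 2 ^ (r + s) * n ^ s
      ≡⟨ cong (λ x → x * x * n ^ s) (^-distribˡ-+-* 2 r s) ⟩
    (2 ^ r * 2 ^ s) * (2 ^ r * 2 ^ s) * n ^ s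
      ≡⟨ rearrange (2 ^ r) (2 ^ s) (n ^ s) ⟩
    (2 ^ s * 2 ^ s) * ((2 ^ r * 2 ^ r) * n ^ s)
      ≡⟨ cong (λ x → (2 ^ s * 2 ^ s) * (x * n ^ s)) (^-distribˡ-+-* 2 r r) ⟨
    (2 ^ s * 2 ^ s) * (2 ^ (r + r) * n ^ s)
      ≤⟨ *-monoʳ-≤ (2 ^ s * 2 ^ s) (2^b*n^a≤2^a*n^b 2≤n (exponent-bound r s 3^s<2^[r+s])) ⟩
    (2 ^ s * 2 ^ s) * (2 ^ s * n ^ (r + r))
      ≡⟨ *-assoc (2 ^ s * 2 ^ s) (2 ^ s) (n ^ (r + r)) ⟨
    2 ^ s * 2 ^ s * 2 ^ s * n ^ (r + r)
      ≡⟨ cong (_* n ^ (r + r)) eight ⟨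
    8 ^ s * n ^ (r + r) ∎
    where
    open ≤-Reasoning
    rearrange : ∀ x y z → (x * y) * (x * y) * z ≡ (y * y) * ((x * x) * z)
    rearrange = solve-∀
    eight : 8 ^ s ≡ 2 ^ s * 2 ^ s * 2 ^ s
    eight = trans (^-distribʳ-* 4 2 s) (cong (_* 2 ^ s) (^-distribʳ-* 2 2 s))

  betaIneq-large : ∀ n N w M → 2 ≤ n → 8 * ((M ∸ N) * (M ∸ N)) ≤ 9 * n * (w * w) → BetaIneq n N w M
  betaIneq-large n N w M 2≤n 8D²≤9nw² r s _ 3^s<2^[r+s] =
    m*m≤n*n⇒m≤n (D ^ s) (w ^ s * n ^ r) (*-cancelˡ-≤ (8 ^ s) {{m^n≢0 8 s}} (begin
      8 ^ s * (D ^ s * D ^ s)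
        ≡⟨ cong (8 ^ s *_) (^-distribʳ-* D D s) ⟨
      8 ^ s * (D * D) ^ s
        ≡⟨ ^-distribʳ-* 8 (D * D) s ⟨
      (8 * (D * D)) ^ s
        ≤⟨ ^-monoˡ-≤ s 8D²≤9nw² ⟩
      (9 * n * (w * w)) ^ s
        ≡⟨ trans (^-distribʳ-* (9 * n) (w * w) s) (cong₂ _*_ (^-distribʳ-* 9 n s) (^-distribʳ-* w w s)) ⟩
      9 ^ s * n ^ s * (w ^ s * w ^ s)
        ≤⟨ *-monoˡ-≤ (w ^ s * w ^ s) (nine-eighths-bound r s 2≤n 3^s<2^[r+s]) ⟩
      8 ^ s * n ^ (r + r) * (w ^ s * w ^ s)
        ≡⟨ cong (λ x → 8 ^ s * x * (w ^ s * w ^ s)) (^-distribˡ-+-* n r r) ⟩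
      8 ^ s * (n ^ r * n ^ r) * (w ^ s * w ^ s)
        ≡⟨ rearrange (8 ^ s) (n ^ r) (w ^ s) ⟩
      8 ^ s * ((w ^ s * n ^ r) * (w ^ s * n ^ r)) ∎))
    where
    open ≤-Reasoning
    D = M ∸ N
    rearrange : ∀ e a b → e * (a * a) * (b * b) ≡ e * ((b * a) * (b * a))
    rearrange = solve-∀

  betaIneq-one : ∀ N w M → M ∸ N ≤ 1 → 8 * ((M ∸ N) * (M ∸ N)) ≤ 9 * 1 * (w * w) → BetaIneq 1 N w M
  betaIneq-one N w M D≤1 8D²≤9w² r s _ _ =
    subst ((M ∸ N) ^ s ≤_) (sym (trans (cong (w ^ s *_) (^-zeroˡ r)) (*-identityʳ (w ^ s))))
          (^-monoˡ-≤ s (D≤w (M ∸ N) w D≤1 8D²≤9w²))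
    where
    D≤w : ∀ D w → D ≤ 1 → 8 * (D * D) ≤ 9 * 1 * (w * w) → D ≤ w
    D≤w zero          w       _        _ = z≤n
    D≤w (suc zero)    (suc w) _        _ = s≤s z≤n
    D≤w (suc zero)    zero    _        ()
    D≤w (suc (suc D)) w       (s≤s ()) _

open import Data.Bool using (Bool)
open import Data.Nat using (zero; suc; _≤_; _*_; _^_; _∸_; z≤n; s≤s)
open import Data.Nat.Properties using (*-cancelˡ-≡; m∸n≤m)
open import Data.Vec using (Vec)
open import Relation.Binary.PropositionalEquality using (_≡_; subst)
open EdgeBoundary using (balanced-squared-bound)
open Exponents using (betaIneq-one; betaIneq-large)

half-cube-squared-bound : ∀ m (part : Vec Bool (suc m) → Part) → 2 * cardA (suc m) part ≡ 2 ^ suc m →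
  let D = 2 ^ m ∸ edgeAB (suc m) part ; w = cardW (suc m) part in
  8 * (D * D) ≤ 9 * suc m * (w * w)
half-cube-squared-bound m part balanced =
  subst (λ a → 8 * ((a ∸ E) * (a ∸ E)) ≤ 9 * suc m * (w * w))
        (*-cancelˡ-≡ (cardA (suc m) part) (2 ^ m) 2 balanced)
        (balanced-squared-bound part balanced)
  where
  E = edgeAB (suc m) part
  w = cardW (suc m) part

corollary1p5 : (n : ℕ) → 1 ≤ n → (part : Vec Bool n → Part) →
    2 * cardA n part ≡ 2 ^ n →
    BetaIneq n (edgeAB n part) (cardW n part) (2 ^ (n ∸ 1))
corollary1p5 n@(suc zero) _ part balanced =
  betaIneq-one (edgeAB n part) (cardW n part) 1 (m∸n≤m 1 (edgeAB n part))
    (half-cube-squared-bound 0 part balanced)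
corollary1p5 n@(suc (suc m)) _ part balanced =
  betaIneq-large n (edgeAB n part) (cardW n part) (2 ^ (n ∸ 1)) (s≤s (s≤s z≤n))
    (half-cube-squared-bound (suc m) part balanced)
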